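{- Let $G$ be a non-complete graph on $n\ge 5$ vertices. Then $\chi_s(G)=n-1$ if and only if $G$ is $(I_3,2K_2)$-free.
   Context: Standing assumption of the paper: all graphs are finite, undirected, simple and connected. A star coloring of $G$ is a proper vertex-coloring such that no path on four vertices (as a subgraph) is colored with only two colors; $\chi_s(G)$ is the minimum number of colors in a star coloring of $G$. $I_3$ is the edgeless graph on three vertices; $2K_2$ is the disjoint union of two edges. $G$ is $(I_3,2K_2)$-free if it contains neither as an induced subgraph. -}

module Defs where

open import Data.Nat using (ℕ; _≤_)
open import Data.Fin using (Fin)
open import Data.Bool using (Bool; true; false)
open import Data.Product using (Σ; _×_; ∃; ∃-syntax)
open import Data.Sum using (_⊎_)
open import Relation.Binary.PropositionalEquality using (_≡_; _≢_)
open import Relation.Nullary using (¬_)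

record Graph (n : ℕ) : Set where
  field
    adj   : Fin n → Fin n → Bool
    sym   : ∀ u v → adj u v ≡ adj v u
    irrefl : ∀ v → adj v v ≡ false
open Graph public

module _ {n : ℕ} (G : Graph n) where

  E : Fin n → Fin n → Set
  E u v = adj G u v ≡ true

  data Reach : Fin n → Fin n → Set where
    here : ∀ {v} → Reach v v
    step : ∀ {u w v} → E u w → Reach w v → Reach u v

  Connected : Set
  Connected = ∀ u v → Reach u v

  NonComplete : Set
  NonComplete = ∃[ u ] ∃[ v ] (u ≢ v × ¬ E u v)

  Proper : {k : ℕ} → (Fin n → Fin k) → Set
  Proper c = ∀ u v → E u v → c u ≢ c v

  IsP4 : Fin n → Fin n → Fin n → Fin n → Set
  IsP4 a b c d =
    a ≢ b × a ≢ c × a ≢ d × b ≢ c × b ≢ d × c ≢ d ×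
    E a b × E b c × E c d

  TwoColored : {k : ℕ} → (Fin n → Fin k) → Fin n → Fin n → Fin n → Fin n → Set
  TwoColored {k} col a b c d =
    ∃[ x ] ∃[ y ] (∀ v → (v ≡ a ⊎ v ≡ b ⊎ v ≡ c ⊎ v ≡ d) → (col v ≡ x ⊎ col v ≡ y))

  StarColoring : {k : ℕ} → (Fin n → Fin k) → Set
  StarColoring col =
    Proper col × (∀ a b c d → IsP4 a b c d → ¬ TwoColored col a b c d)

  StarColorable : ℕ → Set
  StarColorable k = Σ (Fin n → Fin k) StarColoring

  StarChromaticNumberIs : ℕ → Set
  StarChromaticNumberIs m = StarColorable m × (∀ k → StarColorable k → m ≤ k)

  HasInducedI3 : Set
  HasInducedI3 = ∃[ a ] ∃[ b ] ∃[ c ]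
    (a ≢ b × a ≢ c × b ≢ c × ¬ E a b × ¬ E a c × ¬ E b c)

  HasInduced2K2 : Set
  HasInduced2K2 = ∃[ a ] ∃[ b ] ∃[ c ] ∃[ d ]
    (a ≢ b × a ≢ c × a ≢ d × b ≢ c × b ≢ d × c ≢ d ×
     E a b × E c d × ¬ E a c × ¬ E a d × ¬ E b c × ¬ E b d)

  I3-2K2-Free : Set
  I3-2K2-Free = ¬ HasInducedI3 × ¬ HasInduced2K2

{-# OPTIONS --safe #-}
module Submission where

-- Merging the two ends of a non-edge gives a star coloring with n − 1 colors: its only
-- non-singleton color class is an independent pair, which cannot carry both colors of a
-- bicolored P₄.  An induced I₃ (one class of three) or an induced 2K₂ ab, cd (classes
-- {a,c} and {b,d}) yields a star coloring with n − 2 colors in the same way.  Conversely,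
-- a coloring with at most n − 2 colors has a class of three vertices, which is an induced
-- I₃, or two classes {a,b} and {c,d} of two vertices each; in an (I₃,2K₂)-free graph
-- there is then a P₄ alternating between the two pairs, which is bicolored.

open import Defs hiding (sym)
open import Data.Nat using (ℕ; zero; suc; _≤_; _<_; _∸_; s≤s)
open import Data.Nat.Properties using (n≮n; ≮⇒≥; m<n⇒m<1+n)
open import Data.Fin using (Fin; punchOut; punchIn; _≟_)
open import Data.Fin.Properties using (punchOut-injective; punchIn-injective; punchInᵢ≢i; pigeonhole; <⇒≢)
open import Data.Bool using (true)
import Data.Bool as Bool
open import Data.Product using (_×_; _,_; ∃-syntax)
open import Data.Sum using (_⊎_; inj₁; inj₂; [_,_])
open import Data.Empty using (⊥; ⊥-elim)
open import Function using (_∘_)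
open import Function.Bundles using (_⇔_; mk⇔)
open import Relation.Nullary using (¬_; Dec; yes; no)
open import Relation.Binary.PropositionalEquality
  using (_≡_; _≢_; refl; sym; trans; ≢-sym)

private
  variable
    m n k : ℕ

In₂ : Fin n → Fin n → Fin n → Set
In₂ a b v = v ≡ a ⊎ v ≡ b

In₃ : Fin n → Fin n → Fin n → Fin n → Set
In₃ a b c v = v ≡ a ⊎ v ≡ b ⊎ v ≡ c

Both : {A : Set} → (A → Set) → A → A → Set
Both P v w = P v × P w

two-valued-alternates : {A : Set} {x y a b c : A} →
  (a ≡ x ⊎ a ≡ y) → (b ≡ x ⊎ b ≡ y) → (c ≡ x ⊎ c ≡ y) → a ≢ b → b ≢ c → a ≡ c
two-valued-alternates (inj₁ refl) (inj₁ refl) _           a≢b _   = ⊥-elim (a≢b refl)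
two-valued-alternates (inj₁ refl) (inj₂ refl) (inj₁ refl) _   _   = refl
two-valued-alternates (inj₁ refl) (inj₂ refl) (inj₂ refl) _   b≢c = ⊥-elim (b≢c refl)
two-valued-alternates (inj₂ refl) (inj₁ refl) (inj₁ refl) _   b≢c = ⊥-elim (b≢c refl)
two-valued-alternates (inj₂ refl) (inj₁ refl) (inj₂ refl) _   _   = refl
two-valued-alternates (inj₂ refl) (inj₂ refl) _           a≢b _   = ⊥-elim (a≢b refl)

-- j is sent to the image of i; removing the now unused value j closes the gap.
merge : (i j : Fin (suc m)) → i ≢ j → Fin (suc m) → Fin m
merge i j i≢j v with v ≟ j
... | yes _   = punchOut (≢-sym i≢j)
... | no v≢j = punchOut (≢-sym v≢j)

merge-kernel : ∀ {i j : Fin (suc m)} (i≢j : i ≢ j) {v w} →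
  merge i j i≢j v ≡ merge i j i≢j w → v ≡ w ⊎ Both (In₂ i j) v w
merge-kernel {j = j} i≢j {v} {w} eq with v ≟ j | w ≟ j
... | yes v≡j | yes w≡j = inj₂ (inj₂ v≡j , inj₂ w≡j)
... | yes v≡j | no w≢j  = inj₂ (inj₂ v≡j , inj₁ (sym (punchOut-injective (≢-sym i≢j) (≢-sym w≢j) eq)))
... | no v≢j  | yes w≡j = inj₂ (inj₁ (punchOut-injective (≢-sym v≢j) (≢-sym i≢j) eq) , inj₂ w≡j)
... | no v≢j  | no w≢j  = inj₁ (punchOut-injective (≢-sym v≢j) (≢-sym w≢j) eq)

merge-preimage : ∀ {i j : Fin (suc m)} (i≢j : i ≢ j) {v x} →
  merge i j i≢j v ≡ merge i j i≢j x → v ≡ x ⊎ In₂ i j v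
merge-preimage i≢j eq with merge-kernel i≢j eq
... | inj₁ v≡x        = inj₁ v≡x
... | inj₂ (v∈ij , _) = inj₂ v∈ij

merge-injectiveAt : ∀ {i j x : Fin (suc m)} (i≢j : i ≢ j) → x ≢ i → x ≢ j → ∀ {v} →
  merge i j i≢j v ≡ merge i j i≢j x → v ≡ x
merge-injectiveAt i≢j x≢i x≢j eq with merge-kernel i≢j eq
... | inj₁ v≡x                 = v≡x
... | inj₂ (_ , inj₁ x≡i) = ⊥-elim (x≢i x≡i)
... | inj₂ (_ , inj₂ x≡j) = ⊥-elim (x≢j x≡j)

module _ {a b c : Fin (suc (suc m))} (a≢b : a ≢ b) (a≢c : a ≢ c) (b≢c : b ≢ c) where

  private
    μ : Fin (suc (suc m)) → Fin (suc m)
    μ = merge a b a≢b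

    μa≢μc : μ a ≢ μ c
    μa≢μc eq with merge-kernel a≢b eq
    ... | inj₁ a≡c                 = a≢c a≡c
    ... | inj₂ (_ , inj₁ c≡a) = a≢c (sym c≡a)
    ... | inj₂ (_ , inj₂ c≡b) = b≢c (sym c≡b)

    In₂⇒In₃ : ∀ {v} → In₂ a b v → In₃ a b c v
    In₂⇒In₃ (inj₁ v≡a) = inj₁ v≡a
    In₂⇒In₃ (inj₂ v≡b) = inj₂ (inj₁ v≡b)

    preimage : ∀ {v} → In₂ (μ a) (μ c) (μ v) → In₃ a b c v
    preimage (inj₁ eq) with merge-preimage a≢b eq
    ... | inj₁ v≡a  = inj₁ v≡a
    ... | inj₂ v∈ab = In₂⇒In₃ v∈ab
    preimage (inj₂ eq) with merge-preimage a≢b eq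
    ... | inj₁ v≡c  = inj₂ (inj₂ v≡c)
    ... | inj₂ v∈ab = In₂⇒In₃ v∈ab

  merge₃ : Fin (suc (suc m)) → Fin m
  merge₃ = merge (μ a) (μ c) μa≢μc ∘ μ

  merge₃-kernel : ∀ {v w} → merge₃ v ≡ merge₃ w → v ≡ w ⊎ Both (In₃ a b c) v w
  merge₃-kernel eq with merge-kernel μa≢μc eq
  ... | inj₂ (v∈ , w∈) = inj₂ (preimage v∈ , preimage w∈)
  ... | inj₁ μv≡μw with merge-kernel a≢b μv≡μw
  ...   | inj₁ v≡w         = inj₁ v≡w
  ...   | inj₂ (v∈ , w∈) = inj₂ (In₂⇒In₃ v∈ , In₂⇒In₃ w∈)

module _ {a b c d : Fin (suc (suc m))} (a≢b : a ≢ b) (c≢d : c ≢ d)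
         (c≢a : c ≢ a) (c≢b : c ≢ b) (d≢a : d ≢ a) (d≢b : d ≢ b) where

  private
    μ : Fin (suc (suc m)) → Fin (suc m)
    μ = merge a b a≢b

    μc≢μd : μ c ≢ μ d
    μc≢μd = c≢d ∘ sym ∘ merge-injectiveAt a≢b c≢a c≢b ∘ sym

    preimage : ∀ {v} → In₂ (μ c) (μ d) (μ v) → In₂ c d v
    preimage (inj₁ eq) = inj₁ (merge-injectiveAt a≢b c≢a c≢b eq)
    preimage (inj₂ eq) = inj₂ (merge-injectiveAt a≢b d≢a d≢b eq)

  merge₂₂ : Fin (suc (suc m)) → Fin m
  merge₂₂ = merge (μ c) (μ d) μc≢μd ∘ μ

  merge₂₂-kernel : ∀ {v w} → merge₂₂ v ≡ merge₂₂ w →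
    v ≡ w ⊎ Both (In₂ a b) v w ⊎ Both (In₂ c d) v w
  merge₂₂-kernel eq with merge-kernel μc≢μd eq
  ... | inj₂ (v∈ , w∈) = inj₂ (inj₂ (preimage v∈ , preimage w∈))
  ... | inj₁ μv≡μw with merge-kernel a≢b μv≡μw
  ...   | inj₁ v≡w    = inj₁ v≡w
  ...   | inj₂ v,w∈ = inj₂ (inj₁ v,w∈)

module _ (G : Graph n) where

  E-sym : ∀ {u v} → E G u v → E G v u
  E-sym {u} {v} e = trans (Graph.sym G v u) e

  nonEdge-sym : ∀ {u v} → ¬ E G u v → ¬ E G v u
  nonEdge-sym ¬e = ¬e ∘ E-sym

  E-irrefl : ∀ {v} → ¬ E G v v
  E-irrefl {v} e with trans (sym e) (irrefl G v)
  ... | ()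

  E? : ∀ u v → Dec (E G u v)
  E? u v = adj G u v Bool.≟ true

  Independent : (Fin n → Set) → Set
  Independent P = ∀ {v w} → P v → P w → ¬ E G v w

  independent-In₂ : ∀ {a b} → ¬ E G a b → Independent (In₂ a b)
  independent-In₂ _   (inj₁ refl) (inj₁ refl) = E-irrefl
  independent-In₂ ¬ab (inj₁ refl) (inj₂ refl) = ¬ab
  independent-In₂ ¬ab (inj₂ refl) (inj₁ refl) = nonEdge-sym ¬ab
  independent-In₂ _   (inj₂ refl) (inj₂ refl) = E-irrefl

  independent-In₃ : ∀ {a b c} → ¬ E G a b → ¬ E G a c → ¬ E G b c → Independent (In₃ a b c)
  independent-In₃ _   _   _   (inj₁ refl)        (inj₁ refl)        = E-irrefl
  independent-In₃ ¬ab _   _   (inj₁ refl)        (inj₂ (inj₁ refl)) = ¬ab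
  independent-In₃ _   ¬ac _   (inj₁ refl)        (inj₂ (inj₂ refl)) = ¬ac
  independent-In₃ ¬ab _   _   (inj₂ (inj₁ refl)) (inj₁ refl)        = nonEdge-sym ¬ab
  independent-In₃ _   _   _   (inj₂ (inj₁ refl)) (inj₂ (inj₁ refl)) = E-irrefl
  independent-In₃ _   _   ¬bc (inj₂ (inj₁ refl)) (inj₂ (inj₂ refl)) = ¬bc
  independent-In₃ _   ¬ac _   (inj₂ (inj₂ refl)) (inj₁ refl)        = nonEdge-sym ¬ac
  independent-In₃ _   _   ¬bc (inj₂ (inj₂ refl)) (inj₂ (inj₁ refl)) = nonEdge-sym ¬bc
  independent-In₃ _   _   _   (inj₂ (inj₂ refl)) (inj₂ (inj₂ refl)) = E-irrefl

  adjacent-to-pair : ∀ {a b p r q} → In₂ a b p → In₂ a b r → p ≢ r →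
    E G q p → E G q r → E G q a × E G q b
  adjacent-to-pair (inj₁ refl) (inj₁ refl) p≢r _   _   = ⊥-elim (p≢r refl)
  adjacent-to-pair (inj₁ refl) (inj₂ refl) _   eqp eqr = eqp , eqr
  adjacent-to-pair (inj₂ refl) (inj₁ refl) _   eqp eqr = eqr , eqp
  adjacent-to-pair (inj₂ refl) (inj₂ refl) p≢r _   _   = ⊥-elim (p≢r refl)

module _ (G : Graph n) {col : Fin n → Fin k} where

  twoColored⇒alternating : Proper G col → ∀ {p q r s} → IsP4 G p q r s →
    TwoColored G col p q r s → col p ≡ col r × col q ≡ col s
  twoColored⇒alternating proper {p} {q} {r} {s} (_ , _ , _ , _ , _ , _ , epq , eqr , ers) (x , y , in-xy) =
    two-valued-alternates cp cq cr (proper p q epq) (proper q r eqr) ,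
    two-valued-alternates cq cr cs (proper q r eqr) (proper r s ers)
    where
    cp : col p ≡ x ⊎ col p ≡ y
    cp = in-xy p (inj₁ refl)
    cq : col q ≡ x ⊎ col q ≡ y
    cq = in-xy q (inj₂ (inj₁ refl))
    cr : col r ≡ x ⊎ col r ≡ y
    cr = in-xy r (inj₂ (inj₂ (inj₁ refl)))
    cs : col s ≡ x ⊎ col s ≡ y
    cs = in-xy s (inj₂ (inj₂ (inj₂ refl)))

  alternating⇒twoColored : ∀ {p q r s} → col p ≡ col r → col q ≡ col s → TwoColored G col p q r s
  alternating⇒twoColored {p} {q} {r} {s} cp≡cr cq≡cs = col p , col q , colored
    where
    colored : ∀ v → v ≡ p ⊎ v ≡ q ⊎ v ≡ r ⊎ v ≡ s → col v ≡ col p ⊎ col v ≡ col q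
    colored _ (inj₁ refl)                = inj₁ refl
    colored _ (inj₂ (inj₁ refl))         = inj₂ refl
    colored _ (inj₂ (inj₂ (inj₁ refl)))  = inj₁ (sym cp≡cr)
    colored _ (inj₂ (inj₂ (inj₂ refl)))  = inj₂ (sym cq≡cs)

  starColoring-byClasses : (R : Fin n → Fin n → Set) →
    (∀ {v w} → col v ≡ col w → v ≡ w ⊎ R v w) →
    (∀ {v w} → R v w → ¬ E G v w) →
    (∀ {p q r s} → IsP4 G p q r s → R p r → R q s → ⊥) →
    StarColoring G col
  starColoring-byClasses R kernel R-independent no-P4 = proper , star
    where
    proper : Proper G col
    proper v w e cv≡cw with kernel cv≡cw
    ... | inj₁ refl = E-irrefl G e
    ... | inj₂ Rvw  = R-independent Rvw e

    star : ∀ p q r s → IsP4 G p q r s → ¬ TwoColored G col p q r s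
    star p q r s P4@(_ , p≢r , _ , _ , q≢s , _) bicolored
      with twoColored⇒alternating proper P4 bicolored
    ... | cp≡cr , cq≡cs with kernel cp≡cr | kernel cq≡cs
    ... | inj₁ p≡r | _        = p≢r p≡r
    ... | inj₂ _   | inj₁ q≡s = q≢s q≡s
    ... | inj₂ Rpr | inj₂ Rqs = no-P4 P4 Rpr Rqs

  starColoring-byIndependentClass : {P : Fin n → Set} → Independent G P →
    (∀ {v w} → col v ≡ col w → v ≡ w ⊎ Both P v w) → StarColoring G col
  starColoring-byIndependentClass {P} P-independent kernel =
    starColoring-byClasses (Both P) kernel
      (λ (Pv , Pw) → P-independent Pv Pw)
      (λ (_ , _ , _ , _ , _ , _ , epq , _) (Pp , _) (Pq , _) → P-independent Pp Pq epq)

nonComplete⇒starColorable : (G : Graph (suc m)) → NonComplete G → StarColorable G m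
nonComplete⇒starColorable G (u , v , u≢v , ¬uv) =
  merge u v u≢v , starColoring-byIndependentClass G (independent-In₂ G ¬uv) (merge-kernel u≢v)

I₃⇒starColorable : (G : Graph (suc (suc m))) → HasInducedI3 G → StarColorable G m
I₃⇒starColorable G (a , b , c , a≢b , a≢c , b≢c , ¬ab , ¬ac , ¬bc) =
  merge₃ a≢b a≢c b≢c ,
  starColoring-byIndependentClass G (independent-In₃ G ¬ab ¬ac ¬bc) (merge₃-kernel a≢b a≢c b≢c)

-- The classes are the non-edges {a,c} and {b,d}; a P₄ alternating between them would
-- need a vertex of one class adjacent to both vertices of the other.
2K₂⇒starColorable : (G : Graph (suc (suc m))) → HasInduced2K2 G → StarColorable G m
2K₂⇒starColorable {m} G (a , b , c , d , a≢b , a≢c , a≢d , b≢c , b≢d , c≢d , _ , _ , ¬ac , ¬ad , ¬bc , ¬bd) =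
  merge₂₂ a≢c b≢d (≢-sym a≢b) b≢c (≢-sym a≢d) (≢-sym c≢d) ,
  starColoring-byClasses G SameClass (merge₂₂-kernel a≢c b≢d (≢-sym a≢b) b≢c (≢-sym a≢d) (≢-sym c≢d))
    independent no-P4
  where
  SameClass : Fin (suc (suc m)) → Fin (suc (suc m)) → Set
  SameClass v w = Both (In₂ a c) v w ⊎ Both (In₂ b d) v w

  independent : ∀ {v w} → SameClass v w → ¬ E G v w
  independent (inj₁ (v∈ , w∈)) = independent-In₂ G ¬ac v∈ w∈
  independent (inj₂ (v∈ , w∈)) = independent-In₂ G ¬bd v∈ w∈

  no-P4 : ∀ {p q r s} → IsP4 G p q r s → SameClass p r → SameClass q s → ⊥
  no-P4 (_ , _ , _ , _ , _ , _ , epq , _) (inj₁ (p∈ , _)) (inj₁ (q∈ , _)) = independent-In₂ G ¬ac p∈ q∈ epq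
  no-P4 (_ , _ , _ , _ , _ , _ , epq , _) (inj₂ (p∈ , _)) (inj₂ (q∈ , _)) = independent-In₂ G ¬bd p∈ q∈ epq
  no-P4 (_ , p≢r , _ , _ , _ , _ , epq , eqr , _) (inj₁ (p∈ , r∈)) (inj₂ (q∈ , _))
    with adjacent-to-pair G p∈ r∈ p≢r (E-sym G epq) eqr | q∈
  ... | _   , ebc | inj₁ refl = ¬bc ebc
  ... | eda , _   | inj₂ refl = ¬ad (E-sym G eda)
  no-P4 (_ , p≢r , _ , _ , _ , _ , epq , eqr , _) (inj₂ (p∈ , r∈)) (inj₁ (q∈ , _))
    with adjacent-to-pair G p∈ r∈ p≢r (E-sym G epq) eqr | q∈
  ... | _   , ead | inj₁ refl = ¬ad ead
  ... | ecb , _   | inj₂ refl = ¬bc (E-sym G ecb)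

module _ {A : Set} (col : A → Fin k) where

  MonochromaticTriple : Set
  MonochromaticTriple = ∃[ x ] ∃[ y ] ∃[ z ]
    (x ≢ y × x ≢ z × y ≢ z × col x ≡ col y × col x ≡ col z)

  TwoMonochromaticPairs : Set
  TwoMonochromaticPairs = ∃[ a ] ∃[ b ] ∃[ c ] ∃[ d ]
    (a ≢ b × c ≢ d × col a ≡ col b × col c ≡ col d × col a ≢ col c)

-- Pigeonhole gives a pair a, b and then a pair c, d avoiding a; if c has the color of a,
-- then a, c, d is a monochromatic triple.
monochromaticTriple-or-twoPairs : (col : Fin (suc n) → Fin k) → k < n →
  MonochromaticTriple col ⊎ TwoMonochromaticPairs col
monochromaticTriple-or-twoPairs col k<n
  with a , b , a<b , ca≡cb ← pigeonhole (m<n⇒m<1+n k<n) col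
  with i , j , i<j , ci≡cj ← pigeonhole k<n (col ∘ punchIn a)
  with col (punchIn a i) ≟ col a
... | yes ci≡ca = inj₁ (a , punchIn a i , punchIn a j , ≢-sym (punchInᵢ≢i a i) , ≢-sym (punchInᵢ≢i a j) ,
                        punchIn-i≢j , sym ci≡ca , trans (sym ci≡ca) ci≡cj)
  where
  punchIn-i≢j : punchIn a i ≢ punchIn a j
  punchIn-i≢j = <⇒≢ i<j ∘ punchIn-injective a i j
... | no ci≢ca = inj₂ (a , b , punchIn a i , punchIn a j ,
                       <⇒≢ a<b , <⇒≢ i<j ∘ punchIn-injective a i j , ca≡cb , ci≡cj , ci≢ca ∘ sym)

AlternatingP4 : (G : Graph n) → (Fin n → Set) → (Fin n → Set) → Set
AlternatingP4 G P Q = ∃[ x ] ∃[ y ] ∃[ z ] ∃[ w ] (IsP4 G x y z w × P x × Q y × P z × Q w)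

module _ (G : Graph n) (noI₃ : ¬ HasInducedI3 G) (no2K₂ : ¬ HasInduced2K2 G)
         {a b c d : Fin n} (a≢b : a ≢ b) (c≢d : c ≢ d)
         (apart : ∀ {x y} → In₂ a b x → In₂ c d y → x ≢ y)
         (¬ab : ¬ E G a b) (¬cd : ¬ E G c d) where

  private
    zigzag : ∀ {x y z w} → In₂ a b x → In₂ c d y → In₂ a b z → In₂ c d w → x ≢ z → y ≢ w →
      E G x y → E G y z → E G z w → AlternatingP4 G (In₂ a b) (In₂ c d)
    zigzag {x} {y} {z} {w} x∈ y∈ z∈ w∈ x≢z y≢w exy eyz ezw =
      x , y , z , w ,
      (apart x∈ y∈ , x≢z , apart x∈ w∈ , ≢-sym (apart z∈ y∈) , y≢w , apart z∈ w∈ , exy , eyz , ezw) ,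
      x∈ , y∈ , z∈ , w∈

    a∈ : In₂ a b a
    a∈ = inj₁ refl
    b∈ : In₂ a b b
    b∈ = inj₂ refl
    c∈ : In₂ c d c
    c∈ = inj₁ refl
    d∈ : In₂ c d d
    d∈ = inj₂ refl

    a≢c : a ≢ c
    a≢c = apart a∈ c∈
    a≢d : a ≢ d
    a≢d = apart a∈ d∈
    b≢c : b ≢ c
    b≢c = apart b∈ c∈
    b≢d : b ≢ d
    b≢d = apart b∈ d∈

  -- By I₃-freeness each of a, b, c, d has a neighbour in the opposite pair; two such
  -- edges forming a perfect matching give a 2K₂, and three of them a P₄.
  alternatingP4-between-nonEdges : AlternatingP4 G (In₂ a b) (In₂ c d)
  alternatingP4-between-nonEdges with E? G a c | E? G a d | E? G b c | E? G b d
  ... | yes ac | _      | yes bc | yes bd = zigzag a∈ c∈ b∈ d∈ a≢b c≢d ac (E-sym G bc) bd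
  ... | yes ac | yes ad | yes bc | _      = zigzag b∈ c∈ a∈ d∈ (≢-sym a≢b) c≢d bc (E-sym G ac) ad
  ... | yes ac | yes ad | _      | yes bd = zigzag b∈ d∈ a∈ c∈ (≢-sym a≢b) (≢-sym c≢d) bd (E-sym G ad) ac
  ... | _      | yes ad | yes bc | yes bd = zigzag a∈ d∈ b∈ c∈ a≢b (≢-sym c≢d) ad (E-sym G bd) bc
  ... | yes ac | no ¬ad | no ¬bc | yes bd = ⊥-elim (no2K₂
        (a , c , b , d , a≢c , a≢b , a≢d , ≢-sym b≢c , c≢d , b≢d ,
         ac , bd , ¬ab , ¬ad , nonEdge-sym G ¬bc , ¬cd))
  ... | no ¬ac | yes ad | yes bc | no ¬bd = ⊥-elim (no2K₂
        (a , d , b , c , a≢d , a≢b , a≢c , ≢-sym b≢d , ≢-sym c≢d , b≢c ,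
         ad , bc , ¬ab , ¬ac , nonEdge-sym G ¬bd , nonEdge-sym G ¬cd))
  ... | no ¬ac | no ¬ad | _      | _      = ⊥-elim (noI₃ (a , c , d , a≢c , a≢d , c≢d , ¬ac , ¬ad , ¬cd))
  ... | _      | _      | no ¬bc | no ¬bd = ⊥-elim (noI₃ (b , c , d , b≢c , b≢d , c≢d , ¬bc , ¬bd , ¬cd))
  ... | no ¬ac | _      | no ¬bc | _      = ⊥-elim (noI₃ (a , b , c , a≢b , a≢c , b≢c , ¬ab , ¬ac , ¬bc))
  ... | _      | no ¬ad | _      | no ¬bd = ⊥-elim (noI₃ (a , b , d , a≢b , a≢d , b≢d , ¬ab , ¬ad , ¬bd))

module _ (G : Graph n) {col : Fin n → Fin k} where

  monochromaticTriple⇒I₃ : Proper G col → MonochromaticTriple col → HasInducedI3 G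
  monochromaticTriple⇒I₃ proper (x , y , z , x≢y , x≢z , y≢z , cx≡cy , cx≡cz) =
    x , y , z , x≢y , x≢z , y≢z ,
    (λ e → proper x y e cx≡cy) , (λ e → proper x z e cx≡cz) ,
    (λ e → proper y z e (trans (sym cx≡cy) cx≡cz))

  twoMonochromaticPairs⇒bicoloredP4 : ¬ HasInducedI3 G → ¬ HasInduced2K2 G → Proper G col →
    TwoMonochromaticPairs col → ∃[ p ] ∃[ q ] ∃[ r ] ∃[ s ] (IsP4 G p q r s × TwoColored G col p q r s)
  twoMonochromaticPairs⇒bicoloredP4 noI₃ no2K₂ proper (a , b , c , d , a≢b , c≢d , ca≡cb , cc≡cd , ca≢cc) =
    bicolored (alternatingP4-between-nonEdges G noI₃ no2K₂ a≢b c≢d apart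
                 (λ e → proper a b e ca≡cb) (λ e → proper c d e cc≡cd))
    where
    class : ∀ {u v v'} → col u ≡ col v → In₂ u v v' → col v' ≡ col u
    class _     (inj₁ refl) = refl
    class cu≡cv (inj₂ refl) = sym cu≡cv

    apart : ∀ {x y} → In₂ a b x → In₂ c d y → x ≢ y
    apart x∈ y∈ refl = ca≢cc (trans (sym (class ca≡cb x∈)) (class cc≡cd y∈))

    bicolored : AlternatingP4 G (In₂ a b) (In₂ c d) →
      ∃[ p ] ∃[ q ] ∃[ r ] ∃[ s ] (IsP4 G p q r s × TwoColored G col p q r s)
    bicolored (x , y , z , w , P4 , x∈ , y∈ , z∈ , w∈) =
      x , y , z , w , P4 ,
      alternating⇒twoColored G (trans (class ca≡cb x∈) (sym (class ca≡cb z∈)))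
                               (trans (class cc≡cd y∈) (sym (class cc≡cd w∈)))

starColoring-lowerBound : (G : Graph (suc n)) → ¬ HasInducedI3 G → ¬ HasInduced2K2 G →
  ∀ k → StarColorable G k → n ≤ k
starColoring-lowerBound G noI₃ no2K₂ k (col , proper , star) = ≮⇒≥ λ k<n →
  [ noI₃ ∘ monochromaticTriple⇒I₃ G proper
  , noBicoloredP4 ∘ twoMonochromaticPairs⇒bicoloredP4 G noI₃ no2K₂ proper
  ] (monochromaticTriple-or-twoPairs col k<n)
  where
  noBicoloredP4 : ¬ (∃[ p ] ∃[ q ] ∃[ r ] ∃[ s ] (IsP4 G p q r s × TwoColored G col p q r s))
  noBicoloredP4 (p , q , r , s , P4 , bicolored) = star p q r s P4 bicolored

mainTheorem8 : (n : ℕ) → 5 ≤ n → (G : Graph n) → Connected G → NonComplete G →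
    (StarChromaticNumberIs G (n ∸ 1) ⇔ I3-2K2-Free G)
mainTheorem8 zero          ()        _ _ _
mainTheorem8 (suc zero)    (s≤s ())  _ _ _
mainTheorem8 (suc (suc m)) _         G _ nonComplete = mk⇔ necessity sufficiency
  where
  necessity : StarChromaticNumberIs G (suc m) → I3-2K2-Free G
  necessity (_ , minimal) =
    (λ i₃  → n≮n m (minimal m (I₃⇒starColorable G i₃))) ,
    (λ 2k₂ → n≮n m (minimal m (2K₂⇒starColorable G 2k₂)))

  sufficiency : I3-2K2-Free G → StarChromaticNumberIs G (suc m)
  sufficiency (noI₃ , no2K₂) =
    nonComplete⇒starColorable G nonComplete , starColoring-lowerBound G noI₃ no2K₂
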